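{- Let $R$ be a commutative ring and let $F\in R[X_1,\ldots,X_n]^n$ be a polynomial map of the form $F_i=X_i+H_i$, $i=1,\ldots,n$, where each $H_i$ has lower degree $\ge 2$. Let $\widehat{F}(X)=t^{ -1}F(tX)\in (R[t])[X_1,\ldots,X_n]^n$, where $t$ is a new variable. Then $F$ is Pascal finite if and only if $\widehat{F}$ is Pascal finite.
   Context: The lower degree of a polynomial is the minimal total degree of a monomial appearing in it with nonzero coefficient. For a polynomial map $F$ over a commutative ring $A$ (here $A=R$ or $A=R[t]$), define the sequence $P_0(X)=X$, $P_{l+1}=P_l\circ F-P_l$ of polynomial maps in $A[X]^n$. The map $F$ is called Pascal finite if there exists $m$ such that $P_m=0$. -}

module Defs where

open import Level using (Level; _⊔_)
open import Algebra.Bundles using (CommutativeRing)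
open import Data.Nat using (ℕ; zero; suc; _∸_; _<_)
open import Data.Bool using (Bool; true; false; if_then_else_; _∧_)
open import Data.Fin using (Fin; zero; suc)
open import Data.Vec using (Vec; []; _∷_)
open import Data.List using (List; []; _∷_; map; concatMap; upTo; foldr)
open import Data.Product using (_×_; _,_; ∃)

Monomial : ℕ → Set
Monomial n = Vec ℕ n

totalDeg : ∀ {n} → Monomial n → ℕ
totalDeg [] = 0
totalDeg (k ∷ m) = k Data.Nat.+ totalDeg m

isZeroMon : ∀ {n} → Monomial n → Bool
isZeroMon [] = true
isZeroMon (zero ∷ m) = isZeroMon m
isZeroMon (suc _ ∷ m) = false

isVarMon : ∀ {n} → Fin n → Monomial n → Bool
isVarMon zero (1 ∷ m) = isZeroMon m
isVarMon zero (_ ∷ m) = false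
isVarMon (suc i) (zero ∷ m) = isVarMon i m
isVarMon (suc i) (suc _ ∷ m) = false

-- all pairs (a , b) of monomials with a + b = m
splits : ∀ {n} → Monomial n → List (Monomial n × Monomial n)
splits [] = ([] , []) ∷ []
splits (k ∷ m) =
  concatMap (λ i → map (λ ab → (i ∷ Data.Product.proj₁ ab) , ((k ∸ i) ∷ Data.Product.proj₂ ab)) (splits m))
            (upTo (suc k))

module _ {c ℓ : Level} (R : CommutativeRing c ℓ) where
  open CommutativeRing R using (Carrier; _≈_; _+_; _*_; -_; 0#; 1#)

  -- Two expressions denote the same polynomial iff all their coefficients agree
  -- (see _≈P_), so polynomials are R[X_1..X_n] up to this equivalence.
  data Poly (n : ℕ) : Set c where
    con : Carrier → Poly n
    var : Fin n → Poly n
    _⊕_ : Poly n → Poly n → Poly n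
    _⊗_ : Poly n → Poly n → Poly n
    ⊝_  : Poly n → Poly n

  sumR : List Carrier → Carrier
  sumR = foldr _+_ 0#

  coeff : ∀ {n} → Poly n → Monomial n → Carrier
  coeff (con r) m = if isZeroMon m then r else 0#
  coeff (var i) m = if isVarMon i m then 1# else 0#
  coeff (p ⊕ q) m = coeff p m + coeff q m
  coeff (p ⊗ q) m = sumR (map (λ ab → coeff p (Data.Product.proj₁ ab) * coeff q (Data.Product.proj₂ ab)) (splits m))
  coeff (⊝ p) m = - coeff p m

  _≈P_ : ∀ {n} → Poly n → Poly n → Set ℓ
  p ≈P q = ∀ m → coeff p m ≈ coeff q m

  IsZeroPoly : ∀ {n} → Poly n → Set ℓ
  IsZeroPoly p = ∀ m → coeff p m ≈ 0#

  LowerDegGE : ∀ {n} → ℕ → Poly n → Set ℓ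
  LowerDegGE d p = ∀ m → totalDeg m < d → coeff p m ≈ 0#

  subst : ∀ {m k} → Poly m → (Fin m → Poly k) → Poly k
  subst (con r) σ = con r
  subst (var i) σ = σ i
  subst (p ⊕ q) σ = subst p σ ⊕ subst q σ
  subst (p ⊗ q) σ = subst p σ ⊗ subst q σ
  subst (⊝ p) σ = ⊝ subst p σ

  pascal : ∀ {n} → (Fin n → Poly n) → ℕ → Fin n → Poly n
  pascal F zero i = var i
  pascal F (suc l) i = subst (pascal F l i) F ⊕ (⊝ pascal F l i)

  PascalFinite : ∀ {n} → (Fin n → Poly n) → Set ℓ
  PascalFinite {n} F = ∃ λ m → ∀ i → IsZeroPoly (pascal F m i)

  -- (R[t])[X_1..X_n] is represented as R[t, X_1..X_n] = Poly (suc n),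
  -- with t = var zero and X_j = var (suc j).
  tvar : ∀ {n} → Poly (suc n)
  tvar = var zero

  Xvar : ∀ {n} → Fin n → Poly (suc n)
  Xvar j = var (suc j)

  -- Pascal sequence over R[t]: composition substitutes only the X-variables,
  -- t is a constant of the coefficient ring R[t].
  pascalT : ∀ {n} → (Fin n → Poly (suc n)) → ℕ → Fin n → Poly (suc n)
  pascalT G zero i = Xvar i
  pascalT G (suc l) i =
    subst (pascalT G l i) (λ { zero → tvar ; (suc j) → G j }) ⊕ (⊝ pascalT G l i)

  PascalFiniteT : ∀ {n} → (Fin n → Poly (suc n)) → Set ℓ
  PascalFiniteT G = ∃ λ m → ∀ i → IsZeroPoly (pascalT G m i)

  scaleByT : ∀ {n} → Poly n → Poly (suc n)
  scaleByT p = subst p (λ j → tvar ⊗ Xvar j)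

  -- G is the map t^{-1} F(tX): t · G_i = F_i(tX) in R[t][X] for every i
  -- (t is a non-zero-divisor, so G is uniquely determined by this).
  IsHat : ∀ {n} → (Fin n → Poly n) → (Fin n → Poly (suc n)) → Set ℓ
  IsHat F G = ∀ i → (tvar ⊗ G i) ≈P scaleByT (F i)

module Submission where

-- The argument works for any polynomial map F (the lower-degree hypothesis on H only
-- guarantees that F̂ exists, and F̂ is given).  Writing Pₗ, P̂ₗ for the Pascal sequences of
-- F and F̂, induction on l gives  t·P̂ₗ = Pₗ(tX)  in R[t,X].  If Pₘ = 0 then t·P̂ₘ = 0,
-- so P̂ₘ = 0 since t is not a zero divisor; if P̂ₘ = 0 then Pₘ(tX) = 0, and
-- specialising t to 1 gives Pₘ = 0.

open import Level using (Level)
open import Algebra.Bundles using (CommutativeRing)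
open import Algebra.Structures using (IsCommutativeRing)
open import Algebra.Morphism.Bundles using (RingHomomorphism)
import Algebra.Morphism.Construct.Identity as IdentityMorphism
import Algebra.Morphism.Construct.Composition as CompositionMorphism
import Algebra.Properties.CommutativeSemigroup as CommutativeSemigroupProperties
import Algebra.Properties.Ring as RingProperties
open import Relation.Binary.Structures using (IsEquivalence)
open import Data.Nat using (ℕ; zero; suc; _∸_)
open import Data.Fin using (Fin; zero; suc)
open import Data.Vec using ([]; _∷_)
open import Data.Bool using (if_then_else_)
open import Data.Product using (_,_; proj₁; proj₂)
open import Data.List using (List; []; _∷_; map; foldr; concatMap; _++_; upTo; applyUpTo)
open import Data.List.Properties using (map-++; map-∘; map-upTo)
open import Function using (_∘_)
open import Function.Bundles using (_⇔_; mk⇔)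
open import Relation.Binary.PropositionalEquality as ≡ using (_≡_)
import Relation.Binary.Reasoning.Setoid as SetoidReasoning
open import Defs

module ListSum {c ℓ} (A : CommutativeRing c ℓ) where
  open CommutativeRing A
  open SetoidReasoning setoid

  Σ : List Carrier → Carrier
  Σ = foldr _+_ 0#

  Σ-cong : ∀ {a} {I : Set a} (f g : I → Carrier) (L : List I) →
           (∀ i → f i ≈ g i) → Σ (map f L) ≈ Σ (map g L)
  Σ-cong f g []      f≈g = refl
  Σ-cong f g (i ∷ L) f≈g = +-cong (f≈g i) (Σ-cong f g L f≈g)

  Σ-++ : ∀ xs ys → Σ (xs ++ ys) ≈ Σ xs + Σ ys
  Σ-++ []       ys = sym (+-identityˡ _)
  Σ-++ (x ∷ xs) ys = trans (+-congˡ (Σ-++ xs ys)) (sym (+-assoc _ _ _))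

  Σ-concatMap : ∀ {a b} {I : Set a} {J : Set b} (f : J → Carrier) (blocks : I → List J) (L : List I) →
                Σ (map f (concatMap blocks L)) ≈ Σ (map (λ i → Σ (map f (blocks i))) L)
  Σ-concatMap f blocks []      = refl
  Σ-concatMap f blocks (i ∷ L) = begin
    Σ (map f (blocks i ++ concatMap blocks L))
      ≡⟨ ≡.cong Σ (map-++ f (blocks i) (concatMap blocks L)) ⟩
    Σ (map f (blocks i) ++ map f (concatMap blocks L))
      ≈⟨ Σ-++ (map f (blocks i)) (map f (concatMap blocks L)) ⟩
    Σ (map f (blocks i)) + Σ (map f (concatMap blocks L))
      ≈⟨ +-congˡ (Σ-concatMap f blocks L) ⟩
    Σ (map f (blocks i)) + Σ (map (λ i → Σ (map f (blocks i))) L) ∎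

module PowerSeries {c ℓ} (A : CommutativeRing c ℓ) where
  open CommutativeRing A
  open CommutativeSemigroupProperties +-commutativeSemigroup using (interchange)
  open RingProperties ring using (-0#≈0#)
  open SetoidReasoning setoid
  open ListSum A using (Σ)

  Ser : Set c
  Ser = ℕ → Carrier

  infix  4 _≋_
  infixl 6 _⊞_
  infixl 7 _⊠_

  _≋_ : Ser → Ser → Set ℓ
  f ≋ g = ∀ k → f k ≈ g k

  shift : Ser → Ser
  shift f k = f (suc k)

  _⊞_ : Ser → Ser → Ser
  (f ⊞ g) k = f k + g k

  ⊟_ : Ser → Ser
  (⊟ f) k = - f k

  const : Carrier → Ser
  const a zero    = a
  const a (suc _) = 0#

  𝟘 : Ser
  𝟘 _ = 0#

  X : Ser
  X zero          = 0#
  X (suc zero)    = 1#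
  X (suc (suc _)) = 0#

  _⊠_ : Ser → Ser → Ser
  (f ⊠ g) zero    = f 0 * g 0
  (f ⊠ g) (suc k) = f 0 * g (suc k) + (shift f ⊠ g) k


  ⊠-cong : ∀ {f f′ g g′} → f ≋ f′ → g ≋ g′ → f ⊠ g ≋ f′ ⊠ g′
  ⊠-cong f≋ g≋ zero    = *-cong (f≋ 0) (g≋ 0)
  ⊠-cong f≋ g≋ (suc k) = +-cong (*-cong (f≋ 0) (g≋ (suc k))) (⊠-cong (λ i → f≋ (suc i)) g≋ k)

  ⊠-zeroˡ : ∀ f g → f ≋ 𝟘 → f ⊠ g ≋ 𝟘
  ⊠-zeroˡ f g f≋0 zero    = trans (*-congʳ (f≋0 0)) (zeroˡ _)
  ⊠-zeroˡ f g f≋0 (suc k) =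
    trans (+-cong (trans (*-congʳ (f≋0 0)) (zeroˡ _)) (⊠-zeroˡ (shift f) g (λ i → f≋0 (suc i)) k))
          (+-identityʳ 0#)

  ⊠-identityˡ : ∀ g → const 1# ⊠ g ≋ g
  ⊠-identityˡ g zero    = *-identityˡ _
  ⊠-identityˡ g (suc k) =
    trans (+-cong (*-identityˡ _) (⊠-zeroˡ (shift (const 1#)) g (λ _ → refl) k)) (+-identityʳ _)

  ⊠-distribʳ : ∀ h f g → (f ⊞ g) ⊠ h ≋ f ⊠ h ⊞ g ⊠ h
  ⊠-distribʳ h f g zero    = distribʳ _ _ _
  ⊠-distribʳ h f g (suc k) = begin
    (f 0 + g 0) * h (suc k) + ((shift f ⊞ shift g) ⊠ h) k
      ≈⟨ +-cong (distribʳ _ _ _) (⊠-distribʳ h (shift f) (shift g) k) ⟩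
    (f 0 * h (suc k) + g 0 * h (suc k)) + ((shift f ⊠ h) k + (shift g ⊠ h) k)
      ≈⟨ interchange _ _ _ _ ⟩
    (f ⊠ h) (suc k) + (g ⊠ h) (suc k) ∎

  ⊠-distribˡ : ∀ h f g → h ⊠ (f ⊞ g) ≋ h ⊠ f ⊞ h ⊠ g
  ⊠-distribˡ h f g zero    = distribˡ _ _ _
  ⊠-distribˡ h f g (suc k) = begin
    h 0 * (f (suc k) + g (suc k)) + (shift h ⊠ (f ⊞ g)) k
      ≈⟨ +-cong (distribˡ _ _ _) (⊠-distribˡ (shift h) f g k) ⟩
    (h 0 * f (suc k) + h 0 * g (suc k)) + ((shift h ⊠ f) k + (shift h ⊠ g) k)
      ≈⟨ interchange _ _ _ _ ⟩
    (h ⊠ f) (suc k) + (h ⊠ g) (suc k) ∎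

  ⊠-scaleˡ : ∀ a f g → (λ i → a * f i) ⊠ g ≋ (λ k → a * (f ⊠ g) k)
  ⊠-scaleˡ a f g zero    = *-assoc _ _ _
  ⊠-scaleˡ a f g (suc k) = begin
    a * f 0 * g (suc k) + ((λ i → a * f (suc i)) ⊠ g) k
      ≈⟨ +-cong (*-assoc _ _ _) (⊠-scaleˡ a (shift f) g k) ⟩
    a * (f 0 * g (suc k)) + a * (shift f ⊠ g) k
      ≈⟨ sym (distribˡ _ _ _) ⟩
    a * (f ⊠ g) (suc k) ∎

  ⊠-assoc : ∀ f g h → (f ⊠ g) ⊠ h ≋ f ⊠ (g ⊠ h)
  ⊠-assoc f g h zero    = *-assoc _ _ _
  ⊠-assoc f g h (suc k) = begin
    f 0 * g 0 * h (suc k) + (shift (f ⊠ g) ⊠ h) k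
      ≈⟨ +-congˡ (⊠-distribʳ h (λ i → f 0 * g (suc i)) (shift f ⊠ g) k) ⟩
    f 0 * g 0 * h (suc k) + (((λ i → f 0 * g (suc i)) ⊠ h) k + ((shift f ⊠ g) ⊠ h) k)
      ≈⟨ +-cong (*-assoc _ _ _) (+-cong (⊠-scaleˡ (f 0) (shift g) h k) (⊠-assoc (shift f) g h k)) ⟩
    f 0 * (g 0 * h (suc k)) + (f 0 * (shift g ⊠ h) k + (shift f ⊠ (g ⊠ h)) k)
      ≈⟨ sym (+-assoc _ _ _) ⟩
    (f 0 * (g 0 * h (suc k)) + f 0 * (shift g ⊠ h) k) + (shift f ⊠ (g ⊠ h)) k
      ≈⟨ +-congʳ (sym (distribˡ _ _ _)) ⟩
    (f ⊠ (g ⊠ h)) (suc k) ∎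

  ⊠-comm : ∀ f g → f ⊠ g ≋ g ⊠ f
  ⊠-comm f g zero          = *-comm _ _
  ⊠-comm f g (suc zero)    = begin
    f 0 * g 1 + f 1 * g 0 ≈⟨ +-comm _ _ ⟩
    f 1 * g 0 + f 0 * g 1 ≈⟨ +-cong (*-comm _ _) (*-comm _ _) ⟩
    g 0 * f 1 + g 1 * f 0 ∎
  ⊠-comm f g (suc (suc k)) = begin
    f 0 * g (2+ k) + (shift f ⊠ g) (suc k)
      ≈⟨ +-congˡ (⊠-comm (shift f) g (suc k)) ⟩
    f 0 * g (2+ k) + (g 0 * f (2+ k) + (shift g ⊠ shift f) k)
      ≈⟨ +-congˡ (+-congˡ (⊠-comm (shift g) (shift f) k)) ⟩
    f 0 * g (2+ k) + (g 0 * f (2+ k) + (shift f ⊠ shift g) k)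
      ≈⟨ sym (+-assoc _ _ _) ⟩
    (f 0 * g (2+ k) + g 0 * f (2+ k)) + (shift f ⊠ shift g) k
      ≈⟨ +-congʳ (+-comm _ _) ⟩
    (g 0 * f (2+ k) + f 0 * g (2+ k)) + (shift f ⊠ shift g) k
      ≈⟨ +-assoc _ _ _ ⟩
    g 0 * f (2+ k) + (f ⊠ shift g) (suc k)
      ≈⟨ +-congˡ (⊠-comm f (shift g) (suc k)) ⟩
    g 0 * f (2+ k) + (shift g ⊠ f) (suc k) ∎
    where 2+ : ℕ → ℕ
          2+ k = suc (suc k)

  series-isCommutativeRing : IsCommutativeRing _≋_ _⊞_ _⊠_ ⊟_ 𝟘 (const 1#)
  series-isCommutativeRing = record
    { isRing = record
      { +-isAbelianGroup = record
        { isGroup = record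
          { isMonoid = record
            { isSemigroup = record
              { isMagma = record
                { isEquivalence = ≋-isEquivalence
                ; ∙-cong = λ f≋ g≋ k → +-cong (f≋ k) (g≋ k) }
              ; assoc = λ f g h k → +-assoc _ _ _ }
            ; identity = (λ f k → +-identityˡ _) , (λ f k → +-identityʳ _) }
          ; inverse = (λ f k → -‿inverseˡ _) , (λ f k → -‿inverseʳ _)
          ; ⁻¹-cong = λ f≋ k → -‿cong (f≋ k) }
        ; comm = λ f g k → +-comm _ _ }
      ; *-cong = ⊠-cong
      ; *-assoc = ⊠-assoc
      ; *-identity = ⊠-identityˡ , (λ g k → trans (⊠-comm g (const 1#) k) (⊠-identityˡ g k))
      ; distrib = ⊠-distribˡ , ⊠-distribʳ }
    ; *-comm = ⊠-comm }
    where
    ≋-isEquivalence : IsEquivalence _≋_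
    ≋-isEquivalence = record
      { refl = λ k → refl ; sym = λ f≋g k → sym (f≋g k) ; trans = λ f≋g g≋h k → trans (f≋g k) (g≋h k) }

  series : CommutativeRing c ℓ
  series = record { isCommutativeRing = series-isCommutativeRing }

  const-homomorphism : RingHomomorphism rawRing (CommutativeRing.rawRing series)
  const-homomorphism = record
    { ⟦_⟧ = const
    ; isRingHomomorphism = record
      { isSemiringHomomorphism = record
        { isNearSemiringHomomorphism = record
          { +-isMonoidHomomorphism = record
            { isMagmaHomomorphism = record
              { isRelHomomorphism = record { cong = const-cong }
              ; homo = const-+ }
            ; ε-homo = λ { zero → refl ; (suc _) → refl } }
          ; *-homo = const-* }
        ; 1#-homo = λ k → refl }
      ; -‿homo = λ { a zero → refl ; a (suc _) → sym -0#≈0# } } }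
    where
    const-cong : ∀ {a b} → a ≈ b → const a ≋ const b
    const-cong a≈b zero    = a≈b
    const-cong a≈b (suc _) = refl

    const-+ : ∀ a b → const (a + b) ≋ const a ⊞ const b
    const-+ a b zero    = refl
    const-+ a b (suc _) = sym (+-identityʳ 0#)

    const-* : ∀ a b → const (a * b) ≋ const a ⊠ const b
    const-* a b zero    = refl
    const-* a b (suc k) =
      sym (trans (+-cong (zeroʳ a) (⊠-zeroˡ (shift (const a)) (const b) (λ _ → refl) k)) (+-identityʳ 0#))

  -- multiplication by X shifts coefficients, so X is not a zero divisor
  X-cancel : ∀ f → X ⊠ f ≋ 𝟘 → f ≋ 𝟘
  X-cancel f Xf≋0 k = trans (sym Xf≈f) (Xf≋0 (suc k))
    where
    Xf≈f : (X ⊠ f) (suc k) ≈ f k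
    Xf≈f = begin
      0# * f (suc k) + (shift X ⊠ f) k ≈⟨ +-cong (zeroˡ _) (⊠-cong {g′ = f} (λ { zero → refl ; (suc _) → refl }) (λ _ → refl) k) ⟩
      0# + (const 1# ⊠ f) k            ≈⟨ +-identityˡ _ ⟩
      (const 1# ⊠ f) k                 ≈⟨ ⊠-identityˡ f k ⟩
      f k ∎

  ⊠-as-sum : ∀ f g k → Σ (map (λ i → f i * g (k ∸ i)) (upTo (suc k))) ≈ (f ⊠ g) k
  ⊠-as-sum f g zero    = +-identityʳ _
  ⊠-as-sum f g (suc k) = +-congˡ (begin
    Σ (map (λ i → f i * g (suc k ∸ i)) (applyUpTo suc (suc k)))
      ≡⟨ ≡.cong (λ L → Σ (map (λ i → f i * g (suc k ∸ i)) L)) (≡.sym (map-upTo suc (suc k))) ⟩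
    Σ (map (λ i → f i * g (suc k ∸ i)) (map suc (upTo (suc k))))
      ≡⟨ ≡.cong Σ (≡.sym (map-∘ (upTo (suc k)))) ⟩
    Σ (map (λ i → f (suc i) * g (k ∸ i)) (upTo (suc k)))
      ≈⟨ ⊠-as-sum (shift f) g k ⟩
    (shift f ⊠ g) k ∎)

module Evaluation {c ℓ c′ ℓ′} (R : CommutativeRing c ℓ) (K : CommutativeRing c′ ℓ′)
                  (h : RingHomomorphism (CommutativeRing.rawRing R) (CommutativeRing.rawRing K)) where
  open CommutativeRing K
  open RingHomomorphism h using (⟦_⟧)

  ev : ∀ {m} → Poly R m → (Fin m → Carrier) → Carrier
  ev (con r) τ = ⟦ r ⟧
  ev (var j) τ = τ j
  ev (p ⊕ q) τ = ev p τ + ev q τ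
  ev (p ⊗ q) τ = ev p τ * ev q τ
  ev (⊝ p)   τ = - ev p τ

  ev-subst : ∀ {m m′} (p : Poly R m) (σ : Fin m → Poly R m′) (τ : Fin m′ → Carrier) →
             ev (subst R p σ) τ ≡ ev p (λ j → ev (σ j) τ)
  ev-subst (con r) σ τ = ≡.refl
  ev-subst (var j) σ τ = ≡.refl
  ev-subst (p ⊕ q) σ τ = ≡.cong₂ _+_ (ev-subst p σ τ) (ev-subst q σ τ)
  ev-subst (p ⊗ q) σ τ = ≡.cong₂ _*_ (ev-subst p σ τ) (ev-subst q σ τ)
  ev-subst (⊝ p)   σ τ = ≡.cong -_ (ev-subst p σ τ)

  ev-cong : ∀ {m} (p : Poly R m) {τ τ′ : Fin m → Carrier} → (∀ j → τ j ≈ τ′ j) → ev p τ ≈ ev p τ′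
  ev-cong (con r) τ≈τ′ = refl
  ev-cong (var j) τ≈τ′ = τ≈τ′ j
  ev-cong (p ⊕ q) τ≈τ′ = +-cong (ev-cong p τ≈τ′) (ev-cong q τ≈τ′)
  ev-cong (p ⊗ q) τ≈τ′ = *-cong (ev-cong p τ≈τ′) (ev-cong q τ≈τ′)
  ev-cong (⊝ p)   τ≈τ′ = -‿cong (ev-cong p τ≈τ′)

-- The ring R[[X₁,…,Xₙ]] = R[[X₂,…,Xₙ]][[X₁]] of formal power series, and the fact
-- that it represents polynomials faithfully: two polynomial expressions have the same
-- coefficients iff they take the same value at the generic point (X₁,…,Xₙ).
module MultiSeries {c ℓ} (R : CommutativeRing c ℓ) where
  open CommutativeRing R using (Carrier; 0#; 1#)
    renaming (_≈_ to _≈R_; _+_ to _R+_; _*_ to _R*_; -_ to R-_)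
  private module R = CommutativeRing R

  MSer : ℕ → CommutativeRing c ℓ
  MSer zero    = R
  MSer (suc n) = PowerSeries.series (MSer n)

  module S (n : ℕ) = CommutativeRing (MSer n)

  ι : ∀ n → RingHomomorphism (CommutativeRing.rawRing R) (S.rawRing n)
  ι zero    = IdentityMorphism.ringHomomorphism (CommutativeRing.ring R)
  ι (suc n) = CompositionMorphism.ringHomomorphism
                {M₁ = CommutativeRing.ring R} {M₂ = S.ring n} {M₃ = S.ring (suc n)}
                (ι n) (PowerSeries.const-homomorphism (MSer n))

  module ι n = RingHomomorphism (ι n)

  X : ∀ n → Fin n → S.Carrier n
  X (suc n) zero    = PowerSeries.X (MSer n)
  X (suc n) (suc j) = PowerSeries.const (MSer n) (X n j)

  module E n = Evaluation R (MSer n) (ι n)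

  ⟨_⟩ : ∀ {n} → Poly R n → S.Carrier n
  ⟨_⟩ {n} p = E.ev n p (X n)

  series : ∀ {n} → (Monomial n → Carrier) → S.Carrier n
  series {zero}  f   = f []
  series {suc n} f k = series (λ v → f (k ∷ v))

  series-cong : ∀ {n} (f g : Monomial n → Carrier) → (∀ v → f v ≈R g v) → S._≈_ n (series f) (series g)
  series-cong {zero}  f g f≈g   = f≈g []
  series-cong {suc n} f g f≈g k = series-cong _ _ (λ v → f≈g (k ∷ v))

  series-injective : ∀ {n} (f g : Monomial n → Carrier) → S._≈_ n (series f) (series g) → ∀ v → f v ≈R g v
  series-injective {zero}  f g f≈g []      = f≈g
  series-injective {suc n} f g f≈g (k ∷ v) = series-injective (λ w → f (k ∷ w)) (λ w → g (k ∷ w)) (f≈g k) v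

  series-0 : ∀ n → S._≈_ n (series {n} (λ _ → 0#)) (S.0# n)
  series-0 zero    = S.refl zero
  series-0 (suc n) k = series-0 n

  series-+ : ∀ {n} (f g : Monomial n → Carrier) →
             S._≈_ n (series (λ v → f v R+ g v)) (S._+_ n (series f) (series g))
  series-+ {zero}  f g   = S.refl zero
  series-+ {suc n} f g k = series-+ (λ v → f (k ∷ v)) (λ v → g (k ∷ v))

  series-neg : ∀ {n} (f : Monomial n → Carrier) → S._≈_ n (series (λ v → R- f v)) (S.-_ n (series f))
  series-neg {zero}  f   = S.refl zero
  series-neg {suc n} f k = series-neg (λ v → f (k ∷ v))

  series-Σ : ∀ {n a} {I : Set a} (f : I → Monomial n → Carrier) (L : List I) →
             S._≈_ n (series (λ v → sumR R (map (λ i → f i v) L))) (ListSum.Σ (MSer n) (map (λ i → series (f i)) L))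
  series-Σ {n} f []      = series-0 n
  series-Σ {n} f (i ∷ L) = S.trans n (series-+ (f i) (λ v → sumR R (map (λ i → f i v) L))) (S.+-congˡ n (series-Σ f L))

  convolution : ∀ {n} → (Monomial n → Carrier) → (Monomial n → Carrier) → Monomial n → Carrier
  convolution f g m = sumR R (map (λ ab → f (proj₁ ab) R* g (proj₂ ab)) (splits m))

  convolution-unfold : ∀ {n} (f g : Monomial (suc n) → Carrier) k v →
    convolution f g (k ∷ v) ≈R
    sumR R (map (λ i → convolution (λ w → f (i ∷ w)) (λ w → g ((k ∸ i) ∷ w)) v) (upTo (suc k)))
  convolution-unfold f g k v =
    R.trans (ListSum.Σ-concatMap R term block (upTo (suc k)))
            (ListSum.Σ-cong R _ _ (upTo (suc k)) (λ i → R.reflexive (≡.cong (sumR R) (≡.sym (map-∘ (splits v))))))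
    where
    term = λ ab → f (proj₁ ab) R* g (proj₂ ab)
    block = λ i → map (λ ab → (i ∷ proj₁ ab) , ((k ∸ i) ∷ proj₂ ab)) (splits v)

  series-convolution : ∀ {n} (f g : Monomial n → Carrier) →
    S._≈_ n (series (convolution f g)) (S._*_ n (series f) (series g))
  series-convolution {zero}  f g   = R.+-identityʳ _
  series-convolution {suc n} f g k = begin
    series (λ v → convolution f g (k ∷ v))
      ≈⟨ series-cong _ _ (convolution-unfold f g k) ⟩
    series (λ v → sumR R (map (λ i → convolution (f′ i) (g′ i) v) (upTo (suc k))))
      ≈⟨ series-Σ (λ i → convolution (f′ i) (g′ i)) (upTo (suc k)) ⟩
    ListSum.Σ (MSer n) (map (λ i → series (convolution (f′ i) (g′ i))) (upTo (suc k)))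
      ≈⟨ ListSum.Σ-cong (MSer n) _ _ (upTo (suc k)) (λ i → series-convolution (f′ i) (g′ i)) ⟩
    ListSum.Σ (MSer n) (map (λ i → S._*_ n (series (f′ i)) (series (g′ i))) (upTo (suc k)))
      ≈⟨ PowerSeries.⊠-as-sum (MSer n) (λ i → series (f′ i)) (λ i → series (λ w → g (i ∷ w))) k ⟩
    S._*_ (suc n) (series f) (series g) k ∎
    where
    open SetoidReasoning (S.setoid n)
    f′ g′ : ℕ → Monomial n → Carrier
    f′ i w = f (i ∷ w)
    g′ i w = g ((k ∸ i) ∷ w)

  series-con : ∀ n r → S._≈_ n (series {n} (λ v → if isZeroMon v then r else 0#)) (ι.⟦ n ⟧ r)
  series-con zero    r         = R.refl
  series-con (suc n) r zero    = series-con n r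
  series-con (suc n) r (suc k) = series-0 n

  series-var : ∀ n (j : Fin n) → S._≈_ n (series {n} (λ v → if isVarMon j v then 1# else 0#)) (X n j)
  series-var (suc n) zero    zero          = series-0 n
  series-var (suc n) zero    (suc zero)    = S.trans n (series-con n 1#) (ι.1#-homo n)
  series-var (suc n) zero    (suc (suc k)) = series-0 n
  series-var (suc n) (suc j) zero          = series-var n j
  series-var (suc n) (suc j) (suc k)       = series-0 n

  series-coeff : ∀ {n} (p : Poly R n) → S._≈_ n (series (coeff R p)) ⟨ p ⟩
  series-coeff {n} (con r) = series-con n r
  series-coeff {n} (var j) = series-var n j
  series-coeff {n} (p ⊕ q) = S.trans n (series-+ (coeff R p) (coeff R q)) (S.+-cong n (series-coeff p) (series-coeff q))
  series-coeff {n} (p ⊗ q) =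
    S.trans n (series-convolution (coeff R p) (coeff R q)) (S.*-cong n (series-coeff p) (series-coeff q))
  series-coeff {n} (⊝ p)   = S.trans n (series-neg (coeff R p)) (S.-‿cong n (series-coeff p))

  ≈P⇒⟨≈⟩ : ∀ {n} (p q : Poly R n) → _≈P_ R p q → S._≈_ n ⟨ p ⟩ ⟨ q ⟩
  ≈P⇒⟨≈⟩ {n} p q p≈q =
    S.trans n (S.sym n (series-coeff p)) (S.trans n (series-cong (coeff R p) (coeff R q) p≈q) (series-coeff q))

  ⟨≈⟩⇒≈P : ∀ {n} (p q : Poly R n) → S._≈_ n ⟨ p ⟩ ⟨ q ⟩ → _≈P_ R p q
  ⟨≈⟩⇒≈P {n} p q p≈q =
    series-injective (coeff R p) (coeff R q) (S.trans n (series-coeff p) (S.trans n p≈q (S.sym n (series-coeff q))))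

  isZero⇒⟨≈0⟩ : ∀ {n} (p : Poly R n) → IsZeroPoly R p → S._≈_ n ⟨ p ⟩ (S.0# n)
  isZero⇒⟨≈0⟩ {n} p p≈0 =
    S.trans n (S.sym n (series-coeff p)) (S.trans n (series-cong (coeff R p) (λ _ → 0#) p≈0) (series-0 n))

  ⟨≈0⟩⇒isZero : ∀ {n} (p : Poly R n) → S._≈_ n ⟨ p ⟩ (S.0# n) → IsZeroPoly R p
  ⟨≈0⟩⇒isZero {n} p p≈0 =
    series-injective (coeff R p) (λ _ → 0#) (S.trans n (series-coeff p) (S.trans n p≈0 (S.sym n (series-0 n))))

-- A normal form mediates between the two meanings
-- of a polynomial expression, its coefficient series and its value at a point of an
-- R-algebra: normalisation preserves both, and the value of a normal form depends only
-- on its coefficient series (normal forms differ from it at most by trailing zeros).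
module NormalForm {c ℓ} (R : CommutativeRing c ℓ) where
  private module R = CommutativeRing R
  open MultiSeries R

  -- a normal form in m+1 variables is the list of its coefficients, themselves
  -- normal forms in the last m variables, at the powers of the first variable
  data NF : ℕ → Set c where
    nc : R.Carrier → NF zero
    nl : ∀ {m} → List (NF m) → NF (suc m)

  zeroN : ∀ {m} → NF m
  zeroN {zero}  = nc R.0#
  zeroN {suc m} = nl []

  constN : ∀ {m} → R.Carrier → NF m
  constN {zero}  r = nc r
  constN {suc m} r = nl (constN r ∷ [])

  varN : ∀ {m} → Fin m → NF m
  varN {suc m} zero    = nl (zeroN ∷ constN R.1# ∷ [])
  varN {suc m} (suc j) = nl (varN j ∷ [])

  mutual
    addN : ∀ {m} → NF m → NF m → NF m
    addN (nc a) (nc b)   = nc (a R.+ b)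
    addN (nl xs) (nl ys) = nl (addL xs ys)

    addL : ∀ {m} → List (NF m) → List (NF m) → List (NF m)
    addL []       ys       = ys
    addL (x ∷ xs) []       = x ∷ xs
    addL (x ∷ xs) (y ∷ ys) = addN x y ∷ addL xs ys

  mutual
    negN : ∀ {m} → NF m → NF m
    negN (nc a)  = nc (R.- a)
    negN (nl xs) = nl (negL xs)

    negL : ∀ {m} → List (NF m) → List (NF m)
    negL []       = []
    negL (x ∷ xs) = negN x ∷ negL xs

  mutual
    mulN : ∀ {m} → NF m → NF m → NF m
    mulN (nc a) (nc b)   = nc (a R.* b)
    mulN (nl xs) (nl ys) = nl (mulL xs ys)

    scaleL : ∀ {m} → NF m → List (NF m) → List (NF m)
    scaleL x []       = []
    scaleL x (y ∷ ys) = mulN x y ∷ scaleL x ys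

    mulL : ∀ {m} → List (NF m) → List (NF m) → List (NF m)
    mulL []       ys = []
    mulL (x ∷ xs) ys = addL (scaleL x ys) (zeroN ∷ mulL xs ys)

  nf : ∀ {m} → Poly R m → NF m
  nf (con r) = constN r
  nf (var j) = varN j
  nf (p ⊕ q) = addN (nf p) (nf q)
  nf (p ⊗ q) = mulN (nf p) (nf q)
  nf (⊝ p)   = negN (nf p)

  mutual
    nfSeries : ∀ {m} → NF m → S.Carrier m
    nfSeries (nc a)  = a
    nfSeries (nl xs) = nfSeriesL xs

    nfSeriesL : ∀ {m} → List (NF m) → ℕ → S.Carrier m
    nfSeriesL {m} []       k       = S.0# m
    nfSeriesL     (x ∷ xs) zero    = nfSeries x
    nfSeriesL     (x ∷ xs) (suc k) = nfSeriesL xs k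

  nfSeries-zero : ∀ m → S._≈_ m (nfSeries (zeroN {m})) (S.0# m)
  nfSeries-zero zero      = S.refl zero
  nfSeries-zero (suc m) k = S.refl m

  nfSeries-const : ∀ m r → S._≈_ m (nfSeries (constN {m} r)) (ι.⟦ m ⟧ r)
  nfSeries-const zero    r         = S.refl zero
  nfSeries-const (suc m) r zero    = nfSeries-const m r
  nfSeries-const (suc m) r (suc k) = S.refl m

  nfSeries-var : ∀ m (j : Fin m) → S._≈_ m (nfSeries (varN j)) (X m j)
  nfSeries-var (suc m) zero    zero          = nfSeries-zero m
  nfSeries-var (suc m) zero    (suc zero)    = S.trans m (nfSeries-const m R.1#) (ι.1#-homo m)
  nfSeries-var (suc m) zero    (suc (suc k)) = S.refl m
  nfSeries-var (suc m) (suc j) zero          = nfSeries-var m j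
  nfSeries-var (suc m) (suc j) (suc k)       = S.refl m

  mutual
    nfSeries-add : ∀ m (x y : NF m) → S._≈_ m (nfSeries (addN x y)) (S._+_ m (nfSeries x) (nfSeries y))
    nfSeries-add zero    (nc x)  (nc y)  = S.refl zero
    nfSeries-add (suc m) (nl xs) (nl ys) = nfSeriesL-add m xs ys

    nfSeriesL-add : ∀ m (xs ys : List (NF m)) k →
                    S._≈_ m (nfSeriesL (addL xs ys) k) (S._+_ m (nfSeriesL xs k) (nfSeriesL ys k))
    nfSeriesL-add m []       ys       k       = S.sym m (S.+-identityˡ m _)
    nfSeriesL-add m (x ∷ xs) []       k       = S.sym m (S.+-identityʳ m _)
    nfSeriesL-add m (x ∷ xs) (y ∷ ys) zero    = nfSeries-add m x y
    nfSeriesL-add m (x ∷ xs) (y ∷ ys) (suc k) = nfSeriesL-add m xs ys k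

  mutual
    nfSeries-neg : ∀ m (x : NF m) → S._≈_ m (nfSeries (negN x)) (S.-_ m (nfSeries x))
    nfSeries-neg zero    (nc x)  = S.refl zero
    nfSeries-neg (suc m) (nl xs) = nfSeriesL-neg m xs

    nfSeriesL-neg : ∀ m (xs : List (NF m)) k → S._≈_ m (nfSeriesL (negL xs) k) (S.-_ m (nfSeriesL xs k))
    nfSeriesL-neg m []       k       = S.sym m (RingProperties.-0#≈0# (S.ring m))
    nfSeriesL-neg m (x ∷ xs) zero    = nfSeries-neg m x
    nfSeriesL-neg m (x ∷ xs) (suc k) = nfSeriesL-neg m xs k

  mutual
    nfSeries-mul : ∀ m (x y : NF m) → S._≈_ m (nfSeries (mulN x y)) (S._*_ m (nfSeries x) (nfSeries y))
    nfSeries-mul zero    (nc x)  (nc y)  = S.refl zero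
    nfSeries-mul (suc m) (nl xs) (nl ys) = nfSeriesL-mul m xs ys

    nfSeriesL-scale : ∀ m (x : NF m) (ys : List (NF m)) k →
                      S._≈_ m (nfSeriesL (scaleL x ys) k) (S._*_ m (nfSeries x) (nfSeriesL ys k))
    nfSeriesL-scale m x []       k       = S.sym m (S.zeroʳ m _)
    nfSeriesL-scale m x (y ∷ ys) zero    = nfSeries-mul m x y
    nfSeriesL-scale m x (y ∷ ys) (suc k) = nfSeriesL-scale m x ys k

    nfSeriesL-mul : ∀ m (xs ys : List (NF m)) k →
                    S._≈_ m (nfSeriesL (mulL xs ys) k) (S._*_ (suc m) (nfSeriesL xs) (nfSeriesL ys) k)
    nfSeriesL-mul m []       ys k       =
      S.sym m (PowerSeries.⊠-zeroˡ (MSer m) (nfSeriesL {m} []) (nfSeriesL ys) (λ _ → S.refl m) k)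
    nfSeriesL-mul m (x ∷ xs) ys zero    = S.trans m (nfSeriesL-add m (scaleL x ys) (zeroN ∷ mulL xs ys) zero)
      (S.trans m (S.+-cong m (nfSeriesL-scale m x ys zero) (nfSeries-zero m)) (S.+-identityʳ m _))
    nfSeriesL-mul m (x ∷ xs) ys (suc k) = S.trans m (nfSeriesL-add m (scaleL x ys) (zeroN ∷ mulL xs ys) (suc k))
      (S.+-cong m (nfSeriesL-scale m x ys (suc k)) (nfSeriesL-mul m xs ys k))

  nfSeries-nf : ∀ {m} (p : Poly R m) → S._≈_ m (nfSeries (nf p)) ⟨ p ⟩
  nfSeries-nf {m} (con r) = nfSeries-const m r
  nfSeries-nf {m} (var j) = nfSeries-var m j
  nfSeries-nf {m} (p ⊕ q) = S.trans m (nfSeries-add m (nf p) (nf q)) (S.+-cong m (nfSeries-nf p) (nfSeries-nf q))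
  nfSeries-nf {m} (p ⊗ q) = S.trans m (nfSeries-mul m (nf p) (nf q)) (S.*-cong m (nfSeries-nf p) (nfSeries-nf q))
  nfSeries-nf {m} (⊝ p)   = S.trans m (nfSeries-neg m (nf p)) (S.-‿cong m (nfSeries-nf p))

  module _ {c′ ℓ′} (K : CommutativeRing c′ ℓ′)
           (h : RingHomomorphism (CommutativeRing.rawRing R) (CommutativeRing.rawRing K)) where
    open CommutativeRing K hiding (zero)
    open RingHomomorphism h using (⟦_⟧; ⟦⟧-cong; +-homo; *-homo; -‿homo; 0#-homo; 1#-homo)
    open RingProperties ring using (-0#≈0#; -‿+-comm; -‿distribʳ-*)
    open CommutativeSemigroupProperties +-commutativeSemigroup using (interchange)
    open Evaluation R K h
    open SetoidReasoning setoid

    mutual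
      evN : ∀ {m} → (Fin m → Carrier) → NF m → Carrier
      evN τ (nc a)  = ⟦ a ⟧
      evN τ (nl xs) = evL τ xs

      evL : ∀ {m} → (Fin (suc m) → Carrier) → List (NF m) → Carrier
      evL τ []       = 0#
      evL τ (x ∷ xs) = evN (τ ∘ suc) x + τ zero * evL τ xs

    evN-zero : ∀ m (τ : Fin m → Carrier) → evN τ (zeroN {m}) ≈ 0#
    evN-zero zero    τ = 0#-homo
    evN-zero (suc m) τ = refl

    evN-const : ∀ m (τ : Fin m → Carrier) r → evN τ (constN {m} r) ≈ ⟦ r ⟧
    evN-const zero    τ r = refl
    evN-const (suc m) τ r = begin
      evN (τ ∘ suc) (constN r) + τ zero * 0# ≈⟨ +-cong (evN-const m (τ ∘ suc) r) (zeroʳ _) ⟩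
      ⟦ r ⟧ + 0#                             ≈⟨ +-identityʳ _ ⟩
      ⟦ r ⟧                                  ∎

    evN-var : ∀ m (τ : Fin m → Carrier) j → evN τ (varN j) ≈ τ j
    evN-var (suc m) τ zero = begin
      evN (τ ∘ suc) zeroN + τ zero * (evN (τ ∘ suc) (constN R.1#) + τ zero * 0#)
        ≈⟨ +-cong (evN-zero m (τ ∘ suc)) (*-congˡ (+-cong (evN-const m (τ ∘ suc) R.1#) (zeroʳ _))) ⟩
      0# + τ zero * (⟦ R.1# ⟧ + 0#)       ≈⟨ +-identityˡ _ ⟩
      τ zero * (⟦ R.1# ⟧ + 0#)            ≈⟨ *-congˡ (trans (+-identityʳ _) 1#-homo) ⟩
      τ zero * 1#                       ≈⟨ *-identityʳ _ ⟩
      τ zero                            ∎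
    evN-var (suc m) τ (suc j) = begin
      evN (τ ∘ suc) (varN j) + τ zero * 0# ≈⟨ +-cong (evN-var m (τ ∘ suc) j) (zeroʳ _) ⟩
      τ (suc j) + 0#                       ≈⟨ +-identityʳ _ ⟩
      τ (suc j)                            ∎

    mutual
      evN-add : ∀ {m} (τ : Fin m → Carrier) x y → evN τ (addN x y) ≈ evN τ x + evN τ y
      evN-add τ (nc a)  (nc b)  = +-homo a b
      evN-add τ (nl xs) (nl ys) = evL-add τ xs ys

      evL-add : ∀ {m} (τ : Fin (suc m) → Carrier) xs ys → evL τ (addL xs ys) ≈ evL τ xs + evL τ ys
      evL-add τ []       ys       = sym (+-identityˡ _)
      evL-add τ (x ∷ xs) []       = sym (+-identityʳ _)
      evL-add τ (x ∷ xs) (y ∷ ys) = begin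
        evN (τ ∘ suc) (addN x y) + τ zero * evL τ (addL xs ys)
          ≈⟨ +-cong (evN-add (τ ∘ suc) x y) (*-congˡ (evL-add τ xs ys)) ⟩
        (evN (τ ∘ suc) x + evN (τ ∘ suc) y) + τ zero * (evL τ xs + evL τ ys)
          ≈⟨ +-congˡ (distribˡ _ _ _) ⟩
        (evN (τ ∘ suc) x + evN (τ ∘ suc) y) + (τ zero * evL τ xs + τ zero * evL τ ys)
          ≈⟨ interchange _ _ _ _ ⟩
        evL τ (x ∷ xs) + evL τ (y ∷ ys) ∎

    mutual
      evN-neg : ∀ {m} (τ : Fin m → Carrier) x → evN τ (negN x) ≈ - evN τ x
      evN-neg τ (nc a)  = -‿homo a
      evN-neg τ (nl xs) = evL-neg τ xs

      evL-neg : ∀ {m} (τ : Fin (suc m) → Carrier) xs → evL τ (negL xs) ≈ - evL τ xs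
      evL-neg τ []       = sym -0#≈0#
      evL-neg τ (x ∷ xs) = begin
        evN (τ ∘ suc) (negN x) + τ zero * evL τ (negL xs)
          ≈⟨ +-cong (evN-neg (τ ∘ suc) x) (*-congˡ (evL-neg τ xs)) ⟩
        - evN (τ ∘ suc) x + τ zero * (- evL τ xs)
          ≈⟨ +-congˡ (sym (-‿distribʳ-* _ _)) ⟩
        - evN (τ ∘ suc) x + - (τ zero * evL τ xs)
          ≈⟨ -‿+-comm _ _ ⟩
        - evL τ (x ∷ xs) ∎

    mutual
      evN-mul : ∀ {m} (τ : Fin m → Carrier) x y → evN τ (mulN x y) ≈ evN τ x * evN τ y
      evN-mul τ (nc a)  (nc b)  = *-homo a b
      evN-mul τ (nl xs) (nl ys) = evL-mul τ xs ys

      evL-scale : ∀ {m} (τ : Fin (suc m) → Carrier) x ys → evL τ (scaleL x ys) ≈ evN (τ ∘ suc) x * evL τ ys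
      evL-scale τ x []       = sym (zeroʳ _)
      evL-scale τ x (y ∷ ys) = begin
        evN (τ ∘ suc) (mulN x y) + τ zero * evL τ (scaleL x ys)
          ≈⟨ +-cong (evN-mul (τ ∘ suc) x y) (*-congˡ (evL-scale τ x ys)) ⟩
        a * evN (τ ∘ suc) y + τ zero * (a * evL τ ys)
          ≈⟨ +-congˡ (trans (sym (*-assoc _ _ _)) (trans (*-congʳ (*-comm _ _)) (*-assoc _ _ _))) ⟩
        a * evN (τ ∘ suc) y + a * (τ zero * evL τ ys)
          ≈⟨ sym (distribˡ _ _ _) ⟩
        a * evL τ (y ∷ ys) ∎
        where a = evN (τ ∘ suc) x

      evL-mul : ∀ {m} (τ : Fin (suc m) → Carrier) xs ys → evL τ (mulL xs ys) ≈ evL τ xs * evL τ ys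
      evL-mul τ []       ys = sym (zeroˡ _)
      evL-mul {m} τ (x ∷ xs) ys = begin
        evL τ (addL (scaleL x ys) (zeroN ∷ mulL xs ys))
          ≈⟨ evL-add τ (scaleL x ys) (zeroN ∷ mulL xs ys) ⟩
        evL τ (scaleL x ys) + (evN (τ ∘ suc) zeroN + τ zero * evL τ (mulL xs ys))
          ≈⟨ +-cong (evL-scale τ x ys) (+-cong (evN-zero m (τ ∘ suc)) (*-congˡ (evL-mul τ xs ys))) ⟩
        a * B + (0# + τ zero * (evL τ xs * B))
          ≈⟨ +-congˡ (trans (+-identityˡ _) (sym (*-assoc _ _ _))) ⟩
        a * B + τ zero * evL τ xs * B
          ≈⟨ sym (distribʳ _ _ _) ⟩
        (a + τ zero * evL τ xs) * B ∎
        where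
        a = evN (τ ∘ suc) x
        B = evL τ ys

    ev-nf : ∀ {m} (τ : Fin m → Carrier) p → ev p τ ≈ evN τ (nf p)
    ev-nf {m} τ (con r) = sym (evN-const m τ r)
    ev-nf {m} τ (var j) = sym (evN-var m τ j)
    ev-nf τ (p ⊕ q) = trans (+-cong (ev-nf τ p) (ev-nf τ q)) (sym (evN-add τ (nf p) (nf q)))
    ev-nf τ (p ⊗ q) = trans (*-cong (ev-nf τ p) (ev-nf τ q)) (sym (evN-mul τ (nf p) (nf q)))
    ev-nf τ (⊝ p)   = trans (-‿cong (ev-nf τ p)) (sym (evN-neg τ (nf p)))

    mutual
      evN-vanish : ∀ {m} (τ : Fin m → Carrier) x → S._≈_ m (nfSeries x) (S.0# m) → evN τ x ≈ 0#
      evN-vanish τ (nc a)  a≈0  = trans (⟦⟧-cong a≈0) 0#-homo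
      evN-vanish τ (nl xs) xs≈0 = evL-vanish τ xs xs≈0

      evL-vanish : ∀ {m} (τ : Fin (suc m) → Carrier) xs →
                   (∀ k → S._≈_ m (nfSeriesL xs k) (S.0# m)) → evL τ xs ≈ 0#
      evL-vanish τ []       xs≈0 = refl
      evL-vanish τ (x ∷ xs) xs≈0 =
        trans (+-cong (evN-vanish (τ ∘ suc) x (xs≈0 zero)) (*-congˡ (evL-vanish τ xs (λ k → xs≈0 (suc k)))))
              (trans (+-identityˡ _) (zeroʳ _))

    mutual
      evN-resp : ∀ {m} (τ : Fin m → Carrier) x y → S._≈_ m (nfSeries x) (nfSeries y) → evN τ x ≈ evN τ y
      evN-resp τ (nc a)  (nc b)  a≈b   = ⟦⟧-cong a≈b
      evN-resp τ (nl xs) (nl ys) xs≈ys = evL-resp τ xs ys xs≈ys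

      evL-resp : ∀ {m} (τ : Fin (suc m) → Carrier) xs ys →
                 (∀ k → S._≈_ m (nfSeriesL xs k) (nfSeriesL ys k)) → evL τ xs ≈ evL τ ys
      evL-resp     τ []       []       xs≈ys = refl
      evL-resp     τ (x ∷ xs) []       xs≈0  = evL-vanish τ (x ∷ xs) xs≈0
      evL-resp {m} τ []       (y ∷ ys) 0≈ys  = sym (evL-vanish τ (y ∷ ys) (λ k → S.sym m (0≈ys k)))
      evL-resp     τ (x ∷ xs) (y ∷ ys) xs≈ys =
        +-cong (evN-resp (τ ∘ suc) x y (xs≈ys zero)) (*-congˡ (evL-resp τ xs ys (λ k → xs≈ys (suc k))))

    ≈P⇒ev≈ : ∀ {m} (p q : Poly R m) → _≈P_ R p q → ∀ τ → ev p τ ≈ ev q τ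
    ≈P⇒ev≈ {m} p q p≈q τ = begin
      ev p τ         ≈⟨ ev-nf τ p ⟩
      evN τ (nf p)   ≈⟨ evN-resp τ (nf p) (nf q) nf-p≈nf-q ⟩
      evN τ (nf q)   ≈⟨ ev-nf τ q ⟨
      ev q τ         ∎
      where
      nf-p≈nf-q : S._≈_ m (nfSeries (nf p)) (nfSeries (nf q))
      nf-p≈nf-q = S.trans m (nfSeries-nf p) (S.trans m (≈P⇒⟨≈⟩ p q p≈q) (S.sym m (nfSeries-nf q)))

    isZero⇒ev≈0 : ∀ {m} (p : Poly R m) → IsZeroPoly R p → ∀ τ → ev p τ ≈ 0#
    isZero⇒ev≈0 {m} p p≈0 τ =
      trans (ev-nf τ p) (evN-vanish τ (nf p) (S.trans m (nfSeries-nf p) (isZero⇒⟨≈0⟩ p p≈0)))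

module ScalingByT {c ℓ} (R : CommutativeRing c ℓ) (n : ℕ) where
  open MultiSeries R
  open CommutativeRing (MSer (suc n)) hiding (zero)
  open Evaluation R (MSer (suc n)) (ι (suc n))

  t : Carrier
  t = X (suc n) zero

  tX : Fin n → Carrier
  tX j = t * X (suc n) (suc j)

  ⟨scaleByT⟩ : (p : Poly R n) → ⟨ scaleByT R p ⟩ ≡ ev p tX
  ⟨scaleByT⟩ p = ev-subst p (λ j → tvar R ⊗ Xvar R j) (X (suc n))

  t-cancel : ∀ x → t * x ≈ 0# → x ≈ 0#
  t-cancel = PowerSeries.X-cancel (MSer n)

  -- p(tX) = 0 implies p = 0: specialise t to 1
  scaleByT-reflects-zero : (p : Poly R n) → IsZeroPoly R (scaleByT R p) → IsZeroPoly R p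
  scaleByT-reflects-zero p p[tX]≈0 = ⟨≈0⟩⇒isZero p (begin
    ⟨ p ⟩
      ≈⟨ E.ev-cong n p (λ j → S.*-identityˡ n (X n j)) ⟨
    E.ev n p (λ j → S._*_ n (S.1# n) (X n j))
      ≡⟨ E.ev-subst n p (λ j → tvar R ⊗ Xvar R j) τ₁ ⟨
    E.ev n (scaleByT R p) τ₁
      ≈⟨ NormalForm.isZero⇒ev≈0 R (MSer n) (ι n) (scaleByT R p) p[tX]≈0 τ₁ ⟩
    S.0# n ∎)
    where
    open SetoidReasoning (S.setoid n)
    τ₁ : Fin (suc n) → S.Carrier n
    τ₁ zero    = S.1# n
    τ₁ (suc j) = X n j

module Rescaling {c ℓ} (R : CommutativeRing c ℓ) {n : ℕ} (F : Fin n → Poly R n)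
                 (F̂ : Fin n → Poly R (suc n)) (hat : IsHat R F F̂) where
  open MultiSeries R
  open NormalForm R
  open CommutativeRing (MSer (suc n)) hiding (zero)
  open RingProperties ring using (-‿distribʳ-*)
  open Evaluation R (MSer (suc n)) (ι (suc n))
  open ScalingByT R n
  open SetoidReasoning setoid

  ⟨hat⟩ : ∀ j → t * ⟨ F̂ j ⟩ ≈ ev (F j) tX
  ⟨hat⟩ j = trans (≈P⇒⟨≈⟩ (tvar R ⊗ F̂ j) (scaleByT R (F j)) (hat j)) (reflexive (⟨scaleByT⟩ (F j)))

  pascal-rescaling : ∀ l i → t * ⟨ pascalT R F̂ l i ⟩ ≈ ev (pascal R F l i) tX
  pascal-rescaling zero    i = refl
  pascal-rescaling (suc l) i = begin
    t * ⟨ pascalT R F̂ (suc l) i ⟩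
      ≈⟨ distribˡ _ _ _ ⟩
    t * ev (subst R P̂ _) (X (suc n)) + t * - ⟨ P̂ ⟩
      ≈⟨ +-cong (*-congˡ (P̂[σ] _ λ { zero → refl ; (suc j) → refl })) (sym (-‿distribʳ-* _ _)) ⟩
    ev (tvar R ⊗ P̂) τ̂ + - (t * ⟨ P̂ ⟩)
      ≈⟨ +-cong (≈P⇒ev≈ (MSer (suc n)) (ι (suc n)) (tvar R ⊗ P̂) (scaleByT R P) tP̂≈P[tX] τ̂)
                (-‿cong (pascal-rescaling l i)) ⟩
    ev (scaleByT R P) τ̂ + - ev P tX
      ≡⟨ ≡.cong (_+ - ev P tX) (ev-subst P (λ j → tvar R ⊗ Xvar R j) τ̂) ⟩
    ev P (λ j → t * ⟨ F̂ j ⟩) + - ev P tX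
      ≈⟨ +-congʳ (ev-cong P ⟨hat⟩) ⟩
    ev P (λ j → ev (F j) tX) + - ev P tX
      ≡⟨ ≡.cong (_+ - ev P tX) (ev-subst P F tX) ⟨
    ev (subst R P F) tX + - ev P tX ∎
    where
    P̂ = pascalT R F̂ l i
    P = pascal R F l i
    τ̂ : Fin (suc n) → Carrier
    τ̂ zero    = t
    τ̂ (suc j) = ⟨ F̂ j ⟩
    P̂[σ] : ∀ σ → (∀ j → ⟨ σ j ⟩ ≈ τ̂ j) → ⟨ subst R P̂ σ ⟩ ≈ ev P̂ τ̂
    P̂[σ] σ σ≈τ̂ = trans (reflexive (ev-subst P̂ σ (X (suc n)))) (ev-cong P̂ σ≈τ̂)
    tP̂≈P[tX] : _≈P_ R (tvar R ⊗ P̂) (scaleByT R P)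
    tP̂≈P[tX] = ⟨≈⟩⇒≈P (tvar R ⊗ P̂) (scaleByT R P)
                 (trans (pascal-rescaling l i) (reflexive (≡.sym (⟨scaleByT⟩ P))))

  -- Pₘ = 0  ⇒  t·P̂ₘ = Pₘ(tX) = 0  ⇒  P̂ₘ = 0
  forward : PascalFinite R F → PascalFiniteT R F̂
  forward (m , P≈0) = m , λ i → ⟨≈0⟩⇒isZero (pascalT R F̂ m i) (t-cancel _ (begin
    t * ⟨ pascalT R F̂ m i ⟩ ≈⟨ pascal-rescaling m i ⟩
    ev (pascal R F m i) tX  ≈⟨ isZero⇒ev≈0 (MSer (suc n)) (ι (suc n)) (pascal R F m i) (P≈0 i) tX ⟩
    0#                      ∎))

  -- P̂ₘ = 0  ⇒  Pₘ(tX) = t·P̂ₘ = 0  ⇒  Pₘ = 0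
  backward : PascalFiniteT R F̂ → PascalFinite R F
  backward (m , P̂≈0) = m , λ i → scaleByT-reflects-zero (pascal R F m i)
    (⟨≈0⟩⇒isZero (scaleByT R (pascal R F m i)) (begin
      ⟨ scaleByT R (pascal R F m i) ⟩ ≡⟨ ⟨scaleByT⟩ (pascal R F m i) ⟩
      ev (pascal R F m i) tX         ≈⟨ pascal-rescaling m i ⟨
      t * ⟨ pascalT R F̂ m i ⟩        ≈⟨ *-congˡ (isZero⇒⟨≈0⟩ (pascalT R F̂ m i) (P̂≈0 i)) ⟩
      t * 0#                         ≈⟨ zeroʳ t ⟩
      0#                             ∎))

corollary2p1 : {c ℓ : Level} (R : CommutativeRing c ℓ) (n : ℕ)
    (H : Fin n → Poly R n) →
    (∀ i → LowerDegGE R 2 (H i)) →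
    (Fhat : Fin n → Poly R (suc n)) →
    IsHat R (λ i → _⊕_ {R = R} (var i) (H i)) Fhat →
    PascalFinite R (λ i → _⊕_ {R = R} (var i) (H i)) ⇔ PascalFiniteT R Fhat
corollary2p1 R n H _ Fhat hat = mk⇔ forward backward
  where open Rescaling R (λ i → var i ⊕ H i) Fhat hat
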